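{- Let $k\in\mathbb{N}$, let $G$ be the $k^2\times k^2$ grid and $W$ the $k\times k$ grid. Then for every $\gamma:E(G)\to\mathbb{Z}_2$, the signed graph $(G,\gamma)$ contains $(W,\gamma_0)$ as a subdivision.
   Context: The $k\times k$ grid has vertex set $[k]^2$ with $(i,j)$ adjacent to $(i',j')$ iff $|i-i'|+|j-j'|=1$. A signed graph is $(G,\gamma)$ with $\gamma:E(G)\to\mathbb{Z}_2$; the parity of a path is the sum of $\gamma$ over its edges. $\gamma_0$ is the constant $0$ function. Shifting at a vertex $v$ adds $1$ to $\gamma(e)$ for each edge $e$ incident to $v$; a shifting of $(H,\gamma_H)$ is obtained by a sequence of such operations. $(G,\gamma_G)$ contains $(H,\gamma_H)$ as a subdivision if there exist a shifting $(H,\gamma_H')$ of $(H,\gamma_H)$, an injection $\varphi_V:V(H)\to V(G)$, and a map $\varphi_E$ sending the edges of $H$ to internally vertex-disjoint paths in $G$ such that $\varphi_E(uv)$ has ends $\varphi_V(u),\varphi_V(v)$ and the parity of $\varphi_E(uv)$ in $(G,\gamma_G)$ equals $\gamma_H'(uv)$. -}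

module Defs where

open import Data.Nat using (ℕ; _*_; ∣_-_∣; _+_)
open import Data.Fin using (Fin; toℕ) renaming (_<_ to _<ᶠ_)
open import Data.Fin.Properties using () renaming (_≟_ to _≟ᶠ_)
open import Data.Bool using (Bool; false; true; _xor_; if_then_else_)
open import Data.Product using (Σ; _×_; _,_; proj₁; proj₂)
open import Data.Sum using (_⊎_)
open import Data.List using (List; []; _∷_; _++_; foldr)
open import Data.List.Relation.Unary.Unique.Propositional using (Unique)
open import Data.List.Membership.Propositional using (_∈_)
open import Relation.Binary.PropositionalEquality using (_≡_)
open import Relation.Nullary using (¬_; does)
open import Function.Definitions using (Injective)
open import Data.Product.Properties using (≡-dec)

-- Vertices of the k×k grid: [k]^2, realised 0-indexed as Fin k × Fin k.
Vtx : ℕ → Set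
Vtx k = Fin k × Fin k

Adj : ∀ {k} → Vtx k → Vtx k → Set
Adj (i , j) (i' , j') = ∣ toℕ i - toℕ i' ∣ + ∣ toℕ j - toℕ j' ∣ ≡ 1

_≺_ : ∀ {k} → Vtx k → Vtx k → Set
(i , j) ≺ (i' , j') = (i <ᶠ i') ⊎ (i ≡ i' × j <ᶠ j')

-- Edges of the grid: unordered adjacent pairs {u,v}, represented by u ≺ v.
Edge : ℕ → Set
Edge k = Σ (Vtx k × Vtx k) (λ uv → Adj (proj₁ uv) (proj₂ uv) × proj₁ uv ≺ proj₂ uv)

ends : ∀ {k} → Edge k → Vtx k × Vtx k
ends e = proj₁ e

-- A Z₂-signing of the grid's edges (Z₂ = Bool, addition = xor) is given as a
-- function on ordered pairs of vertices which is symmetric; only its values on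
-- adjacent pairs matter.
Signing : ℕ → Set
Signing k = Vtx k → Vtx k → Bool

Symmetric : ∀ {k} → Signing k → Set
Symmetric γ = ∀ u v → γ u v ≡ γ v u

γ₀ : ∀ {k} → Signing k
γ₀ _ _ = false

_≟ᵥ_ : ∀ {k} (u v : Vtx k) → Relation.Nullary.Dec (u ≡ v)
_≟ᵥ_ = ≡-dec _≟ᶠ_ _≟ᶠ_

-- Shifting at v: add 1 to every edge incident with v (grid has no loops).
shiftAt : ∀ {k} → Vtx k → Signing k → Signing k
shiftAt v γ x y = γ x y xor (does (x ≟ᵥ v) xor does (y ≟ᵥ v))

shiftSeq : ∀ {k} → List (Vtx k) → Signing k → Signing k
shiftSeq vs γ = foldr shiftAt γ vs

pathVerts : ∀ {k} → Vtx k → List (Vtx k) → Vtx k → List (Vtx k)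
pathVerts a mid b = a ∷ (mid ++ (b ∷ []))

data IsWalk {k} : List (Vtx k) → Set where
  single : ∀ {u} → IsWalk (u ∷ [])
  step   : ∀ {u v vs} → Adj u v → IsWalk (v ∷ vs) → IsWalk (u ∷ v ∷ vs)

IsPath : ∀ {k} → Vtx k → List (Vtx k) → Vtx k → Set
IsPath a mid b = IsWalk (pathVerts a mid b) × Unique (pathVerts a mid b)

parityL : ∀ {k} → Signing k → List (Vtx k) → Bool
parityL γ [] = false
parityL γ (u ∷ []) = false
parityL γ (u ∷ v ∷ vs) = γ u v xor parityL γ (v ∷ vs)

parity : ∀ {k} → Signing k → Vtx k → List (Vtx k) → Vtx k → Bool
parity γ a mid b = parityL γ (pathVerts a mid b)

-- (grid m, γG) contains (grid n, γH) as a subdivision.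
-- φV : V(H) → V(G) injective; φE e = internal vertices of a path in G
-- between the images of the ends of e; the paths are internally vertex-disjoint
-- and their internal vertices avoid the branch vertices φV(V(H)); the parity of
-- φE e equals γH' e for a shifting γH' = shiftSeq S γH.
ContainsSubdivision : (m : ℕ) → Signing m → (n : ℕ) → Signing n → Set
ContainsSubdivision m γG n γH =
  Σ (List (Vtx n)) λ S →
  Σ (Vtx n → Vtx m) λ φV →
  Σ (Edge n → List (Vtx m)) λ φE →
    Injective _≡_ _≡_ φV
  × (∀ e → IsPath (φV (proj₁ (ends e))) (φE e) (φV (proj₂ (ends e))))
  × (∀ e → parity γG (φV (proj₁ (ends e))) (φE e) (φV (proj₂ (ends e)))
           ≡ shiftSeq S γH (proj₁ (ends e)) (proj₂ (ends e)))
  × (∀ e e' x → x ∈ φE e → x ∈ φE e' → ends e ≡ ends e')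
  × (∀ e x w → x ∈ φE e → ¬ (x ≡ φV w))

-- Cut the k² × k² grid into k block rows of height k and k − 1 block columns of width k + 1, and
-- send the vertex (i , j) of W to the block corner (i k , j (k + 1)).  A vertical edge of W is
-- routed straight down; a horizontal one runs along the top row of its block, possibly dipping
-- down one column, stepping right and climbing back up, which changes its parity by the parity
-- of the boundary of the d × 1 rectangle it skirts.
-- If every block contains an odd such rectangle, every horizontal route can be given either
-- parity, so all route parities can be made f u ⊕ f v, where f (i , j) is the parity of the
-- straight walk from the top of the grid down to the corner of (i , j).  Otherwise some block
-- has only even rectangles; then γ is of the form f u ⊕ f v on the k × k subgrid inside that
-- block, which is itself the required subdivision, with paths of length one.  Either way the
-- parities f u ⊕ f v are those of γ₀ shifted at the vertices where f is true.

module Submission where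

open import Defs
open import Level using (0ℓ)
open import Function using (_∘_; case_of_)
open import Function.Definitions using (Injective)
open import Data.Empty using (⊥-elim)
open import Data.Unit using (⊤; tt)
open import Data.Bool using (Bool; true; false; not; _xor_; T?)
import Data.Bool.Properties as Bool
open import Data.Bool.Properties using (xor-∧-commutativeRing; xor-identityʳ; xor-assoc; xor-comm; xor-same; not-involutive; ¬-not)
open import Data.Maybe using (just; nothing)
open import Data.Nat using (ℕ; zero; suc; pred; _+_; _*_; _∸_; _<_; _≤_; z≤n; s≤s; s≤s⁻¹; ∣_-_∣; NonZero)
open import Data.Nat.DivMod using (_/_; _%_; _mod_; m<n⇒m%n≡m; m<n⇒m/n≡0; [m+kn]%n≡m%n; m*n%n≡0; m*n/n≡m; +-distrib-/)
open import Data.Nat.Properties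
open import Data.Fin using (Fin; toℕ; fromℕ<)
import Data.Fin.Properties as Fin
open import Data.Product using (Σ; ∃₂; _×_; _,_; proj₁; proj₂)
open import Data.Sum using (_⊎_; inj₁; inj₂)
open import Data.List using (List; []; _∷_; _++_; _∷ʳ_; map; replicate; applyUpTo; applyDownFrom; filterᵇ; cartesianProduct; allFin)
open import Data.List.Membership.Propositional using (_∈_; _∉_)
open import Data.List.Membership.Propositional.Properties using (∈-map⁻; ∈-filter⁻; ∈-cartesianProduct⁺; ∈-allFin)
open import Data.List.Relation.Unary.Any as Any using (here; there)
open import Data.List.Relation.Unary.All.Properties using (All¬⇒¬Any; applyUpTo⁺₁; applyDownFrom⁺₁) renaming (++⁺ to All-++⁺; map⁺ to All-map⁺)
open import Data.List.Relation.Binary.Disjoint.Propositional using (Disjoint)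
open import Data.List.Properties using (++-assoc; map-++; applyUpTo-∷ʳ)
open import Data.List.Relation.Unary.All as All using (All; []; _∷_)
open import Data.List.Relation.Unary.AllPairs using ([]; _∷_)
open import Data.List.Relation.Unary.Unique.Propositional using (Unique)
import Data.List.Relation.Unary.Unique.Propositional.Properties as Unique
open import Relation.Binary.PropositionalEquality
open import Relation.Nullary using (¬_; Dec; yes; no; does)
open import Tactic.RingSolver using (solve-∀)
import Data.Nat.Tactic.RingSolver as ℕ-Solver
open import Tactic.RingSolver.Core.AlmostCommutativeRing using (AlmostCommutativeRing; fromCommutativeRing)

ℤ₂ : AlmostCommutativeRing 0ℓ 0ℓ
ℤ₂ = fromCommutativeRing xor-∧-commutativeRing λ { false → just refl ; true → nothing }

replicate-+ : ∀ {A : Set} m n (x : A) → replicate (m + n) x ≡ replicate m x ++ replicate n x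
replicate-+ zero    n x = refl
replicate-+ (suc m) n x = cong (x ∷_) (replicate-+ m n x)

replicate-∷ʳ : ∀ {A : Set} n (x : A) → replicate n x ∷ʳ x ≡ replicate (suc n) x
replicate-∷ʳ zero    x = refl
replicate-∷ʳ (suc n) x = cong (x ∷_) (replicate-∷ʳ n x)

applyUpTo-cong : ∀ {A : Set} {f g : ℕ → A} → (∀ t → f t ≡ g t) → ∀ n → applyUpTo f n ≡ applyUpTo g n
applyUpTo-cong f≗g zero    = refl
applyUpTo-cong f≗g (suc n) = cong₂ _∷_ (f≗g 0) (applyUpTo-cong (f≗g ∘ suc) n)

-- Shifting by a potential

module _ {n : ℕ} where

  oddIn : List (Vtx n) → Vtx n → Bool
  oddIn []      x = false
  oddIn (v ∷ S) x = does (x ≟ᵥ v) xor oddIn S x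

  shiftSeq-oddIn : ∀ S (γ : Signing n) x y → shiftSeq S γ x y ≡ γ x y xor (oddIn S x xor oddIn S y)
  shiftSeq-oddIn []      γ x y = sym (xor-identityʳ (γ x y))
  shiftSeq-oddIn (v ∷ S) γ x y =
    trans (cong (_xor (does (x ≟ᵥ v) xor does (y ≟ᵥ v))) (shiftSeq-oddIn S γ x y))
          (regroup (γ x y) (oddIn S x) (oddIn S y) (does (x ≟ᵥ v)) (does (y ≟ᵥ v)))
    where
    regroup : ∀ g a b c d → (g xor (a xor b)) xor (c xor d) ≡ g xor ((c xor a) xor (d xor b))
    regroup = solve-∀ ℤ₂

  oddIn-∉ : ∀ {x S} → x ∉ S → oddIn S x ≡ false
  oddIn-∉ {S = []}    _   = refl
  oddIn-∉ {x} {v ∷ S} x∉ with x ≟ᵥ v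
  ... | yes x≡v = ⊥-elim (x∉ (here x≡v))
  ... | no  _   = oddIn-∉ (x∉ ∘ there)

  ∉-filterᵇ : ∀ (f : Vtx n → Bool) {x S} → x ∉ S → x ∉ filterᵇ f S
  ∉-filterᵇ f x∉S = x∉S ∘ proj₁ ∘ ∈-filter⁻ (T? ∘ f)

  oddIn-filterᵇ : ∀ f {x S} → Unique S → x ∈ S → oddIn (filterᵇ f S) x ≡ f x
  oddIn-filterᵇ f {x} {v ∷ S} (v∉S ∷ uS) x∈ with f v in fv
  ... | true  with x ≟ᵥ v
  ...   | yes refl = trans (cong (true xor_) (oddIn-∉ (∉-filterᵇ f (All¬⇒¬Any v∉S)))) (sym fv)
  ...   | no  x≢v  = oddIn-filterᵇ f uS (Any.tail x≢v x∈)
  oddIn-filterᵇ f {x} {v ∷ S} (v∉S ∷ uS) x∈ | false with x ≟ᵥ v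
  ...   | yes refl = trans (oddIn-∉ (∉-filterᵇ f (All¬⇒¬Any v∉S))) (sym fv)
  ...   | no  x≢v  = oddIn-filterᵇ f uS (Any.tail x≢v x∈)

  allVertices : List (Vtx n)
  allVertices = cartesianProduct (allFin n) (allFin n)

  support : (Vtx n → Bool) → List (Vtx n)
  support f = filterᵇ f allVertices

  shiftSeq-support : ∀ f x y → shiftSeq (support f) γ₀ x y ≡ f x xor f y
  shiftSeq-support f x@(x₁ , x₂) y@(y₁ , y₂) =
    trans (shiftSeq-oddIn (support f) γ₀ x y)
          (cong₂ _xor_ (oddIn-filterᵇ f allVertices-unique (∈-cartesianProduct⁺ (∈-allFin x₁) (∈-allFin x₂)))
                       (oddIn-filterᵇ f allVertices-unique (∈-cartesianProduct⁺ (∈-allFin y₁) (∈-allFin y₂))))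
    where
    allVertices-unique : Unique allVertices
    allVertices-unique = Unique.cartesianProduct⁺ (Unique.allFin⁺ n) (Unique.allFin⁺ n)

-- Shifting γ₀ at the support of f yields exactly the parities f u xor f v (shiftSeq-support).
record ShiftedSubdivision (m : ℕ) (γ : Signing m) (n : ℕ) : Set where
  field
    branch    : Vtx n → Vtx m
    route     : Edge n → List (Vtx m)
    potential : Vtx n → Bool
    branch-injective : Injective _≡_ _≡_ branch
    route-isPath     : ∀ e → IsPath (branch (proj₁ (ends e))) (route e) (branch (proj₂ (ends e)))
    route-parity     : ∀ e → parity γ (branch (proj₁ (ends e))) (route e) (branch (proj₂ (ends e)))
                               ≡ potential (proj₁ (ends e)) xor potential (proj₂ (ends e))
    routes-disjoint  : ∀ e e' x → x ∈ route e → x ∈ route e' → ends e ≡ ends e'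
    routes-avoid-branches : ∀ e x w → x ∈ route e → x ≢ branch w

toContainsSubdivision : ∀ {m γ n} → ShiftedSubdivision m γ n → ContainsSubdivision m γ n γ₀
toContainsSubdivision M =
  support potential , branch , route , branch-injective , route-isPath ,
  (λ e → trans (route-parity e) (sym (shiftSeq-support potential (proj₁ (ends e)) (proj₂ (ends e))))) ,
  routes-disjoint , routes-avoid-branches
  where open ShiftedSubdivision M

emptyGrid-subdivision : ∀ {m} (γ : Signing m) → ShiftedSubdivision m γ 0
emptyGrid-subdivision γ = record
  { branch = λ { (() , _) } ; route = λ { (((() , _) , _) , _) } ; potential = λ { (() , _) }
  ; branch-injective = λ { {() , _} }
  ; route-isPath = λ { (((() , _) , _) , _) } ; route-parity = λ { (((() , _) , _) , _) }
  ; routes-disjoint = λ { (((() , _) , _) , _) } ; routes-avoid-branches = λ { (((() , _) , _) , _) } }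

unit-step : ∀ {a a' b b'} → ∣ a - a' ∣ + ∣ b - b' ∣ ≡ 1 → a < a' → a' ≡ suc a × b ≡ b'
unit-step {zero}  {suc zero} eq _          = refl , ∣m-n∣≡0⇒m≡n (suc-injective eq)
unit-step {suc a} {suc a'}   eq (s≤s a<a') with unit-step {a} {a'} eq a<a'
... | a'≡1+a , b≡b' = cong suc a'≡1+a , b≡b'

data EdgeView {n} : Vtx n × Vtx n → Set where
  horizontal : ∀ i {j j'} → toℕ j' ≡ suc (toℕ j) → EdgeView ((i , j) , (i , j'))
  vertical   : ∀ {i i'} j → toℕ i' ≡ suc (toℕ i) → EdgeView ((i , j) , (i' , j))

edgeView : ∀ {n} (e : Edge n) → EdgeView (ends e)
edgeView (((i , j) , (i' , j')) , adj , inj₁ i<i')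
  with i'≡1+i , j≡j' ← unit-step {toℕ i} {toℕ i'} {toℕ j} {toℕ j'} adj i<i'
  with refl ← Fin.toℕ-injective j≡j' = vertical j i'≡1+i
edgeView (((i , j) , (.i , j')) , adj , inj₂ (refl , j<j')) =
  horizontal i (proj₁ (unit-step {toℕ j} {toℕ j'} {toℕ i} {toℕ i}
                                 (trans (+-comm ∣ toℕ j - toℕ j' ∣ ∣ toℕ i - toℕ i ∣) adj) j<j'))

Adj-irreflexive : ∀ {n} {a : Vtx n} → ¬ Adj a a
Adj-irreflexive {a = a₁ , a₂} adj rewrite ∣n-n∣≡0 (toℕ a₁) | ∣n-n∣≡0 (toℕ a₂) with () ← adj

suc-toℕ<n : ∀ {n} {i i' : Fin n} → toℕ i' ≡ suc (toℕ i) → suc (toℕ i) < n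
suc-toℕ<n {i' = i'} h = subst (_< _) h (Fin.toℕ<n i')

adjacent⇒isPath : ∀ {n} {a b : Vtx n} → Adj a b → IsPath a [] b
adjacent⇒isPath {a = a} adj = step adj single , ((λ { refl → Adj-irreflexive {a = a} adj }) ∷ []) ∷ [] ∷ []

-- Walks in the lattice ℕ × ℕ

Point : Set
Point = ℕ × ℕ

data Move : Set where
  right down up : Move

-- Rows grow downwards; a step up from row 0 is junk, excluded by IsLatticeWalk.
move : Point → Move → Point
move (r , c) right = r , suc c
move (r , c) down  = suc r , c
move (r , c) up    = pred r , c

trace : Point → List Move → List Point
trace p []       = []
trace p (x ∷ ms) = move p x ∷ trace (move p x) ms

endpoint : Point → List Move → Point
endpoint p []       = p
endpoint p (x ∷ ms) = endpoint (move p x) ms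

trace-++ : ∀ {p q} ms ns → endpoint p ms ≡ q → trace p (ms ++ ns) ≡ trace p ms ++ trace q ns
trace-++         []       ns refl = refl
trace-++ {p = p} (x ∷ ms) ns e    = cong (move p x ∷_) (trace-++ ms ns e)

endpoint-rights : ∀ n r c → endpoint (r , c) (replicate n right) ≡ (r , c + n)
endpoint-rights zero    r c = cong (r ,_) (sym (+-identityʳ c))
endpoint-rights (suc n) r c = trans (endpoint-rights n r (suc c)) (cong (r ,_) (sym (+-suc c n)))

endpoint-downs : ∀ n r c → endpoint (r , c) (replicate n down) ≡ (r + n , c)
endpoint-downs zero    r c = cong (_, c) (sym (+-identityʳ r))
endpoint-downs (suc n) r c = trans (endpoint-downs n (suc r) c) (cong (_, c) (sym (+-suc r n)))

endpoint-ups : ∀ n r c → endpoint (r + n , c) (replicate n up) ≡ (r , c)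
endpoint-ups zero    r c = cong (_, c) (+-identityʳ r)
endpoint-ups (suc n) r c rewrite +-suc r n = endpoint-ups n r c

trace-rights : ∀ n r c → trace (r , c) (replicate n right) ≡ applyUpTo (λ t → r , c + suc t) n
trace-rights zero    r c = refl
trace-rights (suc n) r c =
  cong₂ _∷_ (cong (r ,_) (+-comm 1 c))
            (trans (trace-rights n r (suc c)) (applyUpTo-cong (λ t → cong (r ,_) (sym (+-suc c (suc t)))) n))

trace-downs : ∀ n r c → trace (r , c) (replicate n down) ≡ applyUpTo (λ t → r + suc t , c) n
trace-downs zero    r c = refl
trace-downs (suc n) r c =
  cong₂ _∷_ (cong (_, c) (+-comm 1 r))
            (trans (trace-downs n (suc r) c) (applyUpTo-cong (λ t → cong (_, c) (sym (+-suc r (suc t)))) n))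

trace-ups : ∀ n r c → trace (r + n , c) (replicate n up) ≡ applyDownFrom (λ t → r + t , c) n
trace-ups zero    r c = refl
trace-ups (suc n) r c rewrite +-suc r n = cong ((r + n , c) ∷_) (trace-ups n r c)

downs-unique : ∀ n r c → Unique ((r , c) ∷ trace (r , c) (replicate n down))
downs-unique n r c rewrite trace-downs n r c =
  applyUpTo⁺₁ _ n (λ _ eq → <⇒≢ (m<m+n r (s≤s z≤n)) (cong proj₁ eq)) ∷
  Unique.applyUpTo⁺₁ (λ t → r + suc t , c) n λ i<j _ eq → <⇒≢ i<j (suc-injective (+-cancelˡ-≡ r _ _ (cong proj₁ eq)))

Adjacent : Point → Point → Set
Adjacent (r , c) (r' , c') = ∣ r - r' ∣ + ∣ c - c' ∣ ≡ 1

∣n-1+n∣≡1 : ∀ n → ∣ n - suc n ∣ ≡ 1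
∣n-1+n∣≡1 zero    = refl
∣n-1+n∣≡1 (suc n) = ∣n-1+n∣≡1 n

right-adjacent : ∀ r c → Adjacent (r , c) (move (r , c) right)
right-adjacent r c rewrite ∣n-n∣≡0 r = ∣n-1+n∣≡1 c

down-adjacent : ∀ r c → Adjacent (r , c) (move (r , c) down)
down-adjacent r c rewrite ∣n-n∣≡0 c = trans (+-identityʳ _) (∣n-1+n∣≡1 r)

up-adjacent : ∀ r c → Adjacent (suc r , c) (move (suc r , c) up)
up-adjacent r c rewrite ∣n-n∣≡0 c = trans (+-identityʳ _) (trans (∣-∣-comm (suc r) r) (∣n-1+n∣≡1 r))

IsLatticeWalk : Point → List Move → Set
IsLatticeWalk p []       = ⊤
IsLatticeWalk p (x ∷ ms) = Adjacent p (move p x) × IsLatticeWalk (move p x) ms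

isLatticeWalk-++ : ∀ {p q} ms ns → endpoint p ms ≡ q →
                   IsLatticeWalk p ms → IsLatticeWalk q ns → IsLatticeWalk p (ms ++ ns)
isLatticeWalk-++ []       ns refl _          w = w
isLatticeWalk-++ (x ∷ ms) ns e    (adj , wm) w = adj , isLatticeWalk-++ ms ns e wm w

rights-isLatticeWalk : ∀ n r c → IsLatticeWalk (r , c) (replicate n right)
rights-isLatticeWalk zero    r c = tt
rights-isLatticeWalk (suc n) r c = right-adjacent r c , rights-isLatticeWalk n r (suc c)

downs-isLatticeWalk : ∀ n r c → IsLatticeWalk (r , c) (replicate n down)
downs-isLatticeWalk zero    r c = tt
downs-isLatticeWalk (suc n) r c = down-adjacent r c , downs-isLatticeWalk n (suc r) c

ups-isLatticeWalk : ∀ n r c → IsLatticeWalk (r + n , c) (replicate n up)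
ups-isLatticeWalk zero    r c = tt
ups-isLatticeWalk (suc n) r c rewrite +-suc r n = up-adjacent (r + n) c , ups-isLatticeWalk n r c

LatticeSigning : Set
LatticeSigning = Point → Point → Bool

walkParity : LatticeSigning → Point → List Move → Bool
walkParity σ p []       = false
walkParity σ p (x ∷ ms) = σ p (move p x) xor walkParity σ (move p x) ms

walkParity-++ : ∀ σ {p q} ms ns → endpoint p ms ≡ q →
                walkParity σ p (ms ++ ns) ≡ walkParity σ p ms xor walkParity σ q ns
walkParity-++ σ         []       ns refl = refl
walkParity-++ σ {p = p} (x ∷ ms) ns e    =
  trans (cong (σ p (move p x) xor_) (walkParity-++ σ ms ns e)) (sym (xor-assoc (σ p (move p x)) _ _))

walkParity-∷ʳ : ∀ σ {p q} ms x → endpoint p ms ≡ q →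
                walkParity σ p (ms ∷ʳ x) ≡ walkParity σ p ms xor σ q (move q x)
walkParity-∷ʳ σ ms x e = trans (walkParity-++ σ ms (x ∷ []) e) (cong (walkParity σ _ ms xor_) (xor-identityʳ _))

walkParity-ups : ∀ {σ} → (∀ u v → σ u v ≡ σ v u) →
                 ∀ n r c → walkParity σ (r + n , c) (replicate n up) ≡ walkParity σ (r , c) (replicate n down)
walkParity-ups         σ-sym zero    r c = refl
walkParity-ups {σ = σ} σ-sym (suc n) r c rewrite +-suc r n = begin
  σ (suc (r + n) , c) (r + n , c) xor walkParity σ (r + n , c) (replicate n up)
    ≡⟨ cong₂ _xor_ (σ-sym _ _) (walkParity-ups σ-sym n r c) ⟩
  σ (r + n , c) (suc (r + n) , c) xor walkParity σ (r , c) (replicate n down)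
    ≡⟨ xor-comm (σ (r + n , c) (suc (r + n) , c)) _ ⟩
  walkParity σ (r , c) (replicate n down) xor σ (r + n , c) (suc (r + n) , c)
    ≡⟨ walkParity-∷ʳ σ (replicate n down) down (endpoint-downs n r c) ⟨
  walkParity σ (r , c) (replicate n down ∷ʳ down)
    ≡⟨ cong (walkParity σ (r , c)) (replicate-∷ʳ n down) ⟩
  walkParity σ (r , c) (replicate (suc n) down) ∎
  where open ≡-Reasoning

-- Detours around a rectangle

-- The cycle bounding the d × 1 rectangle with top-left corner (r , a).
rectangleParity : LatticeSigning → Point → ℕ → Bool
rectangleParity σ (r , a) d =
  walkParity σ (r , a) (replicate d down) xor
  (σ (r + d , a) (r + d , suc a) xor (walkParity σ (r , suc a) (replicate d down) xor σ (r , a) (r , suc a)))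

rectangleParity-0 : ∀ σ r a → rectangleParity σ (r , a) 0 ≡ false
rectangleParity-0 σ r a rewrite +-identityʳ r = xor-same (σ (r , a) (r , suc a))

record InBox (lo hi p : Point) : Set where
  constructor box
  field
    lo-row : proj₁ lo ≤ proj₁ p
    hi-row : proj₁ p ≤ proj₁ hi
    lo-col : proj₂ lo ≤ proj₂ p
    hi-col : proj₂ p ≤ proj₂ hi

InBox-weaken : ∀ {lo hi lo' hi'} → proj₁ lo' ≤ proj₁ lo → proj₁ hi ≤ proj₁ hi' → proj₂ lo' ≤ proj₂ lo → proj₂ hi ≤ proj₂ hi' →
               ∀ {p} → InBox lo hi p → InBox lo' hi' p
InBox-weaken r₀ r₁ c₀ c₁ (box lr hr lc hc) = box (≤-trans r₀ lr) (≤-trans hr r₁) (≤-trans c₀ lc) (≤-trans hc c₁)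

separated : ∀ {A : Set} (f : A → ℕ) {b xs ys} → All (λ x → f x ≤ b) xs → All (λ y → b < f y) ys → Disjoint xs ys
separated f xs≤b b<ys (x∈xs , x∈ys) = ≤⇒≯ (All.lookup xs≤b x∈xs) (All.lookup b<ys x∈ys)

module Detour (r c p d q : ℕ) where

  a : ℕ
  a = c + suc p

  walk : List Move
  walk = replicate (suc p) right ++ replicate d down ++ right ∷ replicate d up ++ replicate (suc q) right

  before descent ascent after interior : List Point
  before   = applyUpTo (λ t → r , c + suc t) (suc p)
  descent  = applyUpTo (λ t → r + suc t , a) d
  ascent   = applyDownFrom (λ t → r + t , suc a) (suc d)
  after    = applyUpTo (λ t → r , suc a + suc t) q
  interior = before ++ descent ++ ascent ++ after

  exit : Point
  exit = r , suc a + suc q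

  trace-walk : trace (r , c) walk ≡ interior ∷ʳ exit
  trace-walk = begin
    trace (r , c) walk
      ≡⟨ trace-++ (replicate (suc p) right) _ (endpoint-rights (suc p) r c) ⟩
    trace (r , c) (replicate (suc p) right) ++ trace (r , a) (replicate d down ++ right ∷ replicate d up ++ replicate (suc q) right)
      ≡⟨ cong₂ _++_ (trace-rights (suc p) r c) (trace-++ (replicate d down) _ (endpoint-downs d r a)) ⟩
    before ++ trace (r , a) (replicate d down) ++ (r + d , suc a) ∷ trace (r + d , suc a) (replicate d up ++ replicate (suc q) right)
      ≡⟨ cong (before ++_) (cong₂ _++_ (trace-downs d r a)
                                       (cong ((r + d , suc a) ∷_) (trace-++ (replicate d up) _ (endpoint-ups d r (suc a))))) ⟩
    before ++ descent ++ (r + d , suc a) ∷ trace (r + d , suc a) (replicate d up) ++ trace (r , suc a) (replicate (suc q) right)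
      ≡⟨ cong (λ z → before ++ descent ++ (r + d , suc a) ∷ z)
              (cong₂ _++_ (trace-ups d r (suc a)) (trans (trace-rights (suc q) r (suc a)) (sym (applyUpTo-∷ʳ _ q)))) ⟩
    before ++ descent ++ ascent ++ (after ∷ʳ exit)
      ≡⟨ cong (λ z → before ++ descent ++ z) (sym (++-assoc ascent after _)) ⟩
    before ++ descent ++ (ascent ++ after) ∷ʳ exit
      ≡⟨ cong (before ++_) (sym (++-assoc descent _ _)) ⟩
    before ++ (descent ++ ascent ++ after) ∷ʳ exit
      ≡⟨ ++-assoc before _ _ ⟨
    interior ∷ʳ exit ∎
    where open ≡-Reasoning

  walk-isLatticeWalk : IsLatticeWalk (r , c) walk
  walk-isLatticeWalk =
    isLatticeWalk-++ (replicate (suc p) right) _ (endpoint-rights (suc p) r c) (rights-isLatticeWalk (suc p) r c)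
   (isLatticeWalk-++ (replicate d down) _ (endpoint-downs d r a) (downs-isLatticeWalk d r a)
   (right-adjacent (r + d) a ,
    isLatticeWalk-++ (replicate d up) _ (endpoint-ups d r (suc a)) (ups-isLatticeWalk d r (suc a))
                     (rights-isLatticeWalk (suc q) r (suc a))))

  before-inBox : All (InBox (r , suc c) (r , a)) before
  before-inBox = applyUpTo⁺₁ _ (suc p) λ {t} t<1+p → box ≤-refl ≤-refl (m<m+n c (s≤s z≤n)) (+-monoʳ-≤ c t<1+p)

  descent-inBox : All (InBox (suc r , a) (r + d , a)) descent
  descent-inBox = applyUpTo⁺₁ _ d λ {t} t<d → box (m<m+n r (s≤s z≤n)) (+-monoʳ-≤ r t<d) ≤-refl ≤-refl

  ascent-inBox : All (InBox (r , suc a) (r + d , suc a)) ascent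
  ascent-inBox = applyDownFrom⁺₁ _ (suc d) λ {t} t<1+d → box (m≤m+n r t) (+-monoʳ-≤ r (s≤s⁻¹ t<1+d)) ≤-refl ≤-refl

  after-inBox : All (InBox (r , suc (suc a)) (r , suc a + q)) after
  after-inBox = applyUpTo⁺₁ _ q λ {t} t<q → box ≤-refl ≤-refl (m<m+n (suc a) (s≤s z≤n)) (+-monoʳ-≤ (suc a) t<q)

  interior-inBox : All (InBox (r , suc c) (r + d , suc a + q)) interior
  interior-inBox =
    All-++⁺ (All.map (InBox-weaken ≤-refl (m≤m+n r d) ≤-refl a≤) before-inBox)
   (All-++⁺ (All.map (InBox-weaken (n≤1+n r) ≤-refl c<a a≤) descent-inBox)
   (All-++⁺ (All.map (InBox-weaken ≤-refl ≤-refl (s≤s (<⇒≤ c<a)) (m≤m+n (suc a) q)) ascent-inBox)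
            (All.map (InBox-weaken ≤-refl (m≤m+n r d) (m≤n⇒m≤1+n (s≤s (<⇒≤ c<a))) ≤-refl) after-inBox)))
    where
    c<a : c < a
    c<a = m<m+n c (s≤s z≤n)
    a≤ : a ≤ suc a + q
    a≤ = m≤n⇒m≤1+n (m≤m+n a q)

  walk-unique : Unique ((r , c) ∷ trace (r , c) walk)
  walk-unique rewrite trace-walk =
    Unique.++⁺ ([] ∷ []) (Unique.++⁺ interior-unique ([] ∷ []) interior-before-exit) start-first
    where
    before-unique : Unique before
    before-unique = Unique.applyUpTo⁺₁ (λ t → r , c + suc t) (suc p) λ i<j _ eq →
      <⇒≢ i<j (suc-injective (+-cancelˡ-≡ c _ _ (cong proj₂ eq)))
    descent-unique : Unique descent
    descent-unique = Unique.applyUpTo⁺₁ (λ t → r + suc t , a) d λ i<j _ eq →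
      <⇒≢ i<j (suc-injective (+-cancelˡ-≡ r _ _ (cong proj₁ eq)))
    ascent-unique : Unique ascent
    ascent-unique = Unique.applyDownFrom⁺₁ (λ t → r + t , suc a) (suc d) λ j<i _ eq →
      <⇒≢ j<i (sym (+-cancelˡ-≡ r _ _ (cong proj₁ eq)))
    after-unique : Unique after
    after-unique = Unique.applyUpTo⁺₁ (λ t → r , suc a + suc t) q λ i<j _ eq →
      <⇒≢ i<j (suc-injective (+-cancelˡ-≡ (suc a) _ _ (cong proj₂ eq)))

    interior-unique : Unique interior
    interior-unique = subst Unique (++-assoc before descent _)
      (Unique.++⁺ (Unique.++⁺ before-unique descent-unique
                              (separated proj₁ (All.map InBox.hi-row before-inBox) (All.map InBox.lo-row descent-inBox)))
                  (Unique.++⁺ ascent-unique after-unique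
                              (separated proj₂ (All.map InBox.hi-col ascent-inBox) (All.map InBox.lo-col after-inBox)))
                  (separated proj₂ (All-++⁺ (All.map InBox.hi-col before-inBox) (All.map InBox.hi-col descent-inBox))
                                   (All-++⁺ (All.map InBox.lo-col ascent-inBox)
                                            (All.map (<⇒≤ ∘ InBox.lo-col) after-inBox))))

    interior-before-exit : Disjoint interior (exit ∷ [])
    interior-before-exit = separated proj₂ (All.map InBox.hi-col interior-inBox) (+-monoʳ-< (suc a) (n<1+n q) ∷ [])

    start-first : Disjoint ((r , c) ∷ []) (interior ∷ʳ exit)
    start-first = separated proj₂ (≤-refl ∷ [])
      (All-++⁺ (All.map InBox.lo-col interior-inBox) (≤-trans (s≤s (m≤m+n c (suc p))) (m≤m+n (suc a) (suc q)) ∷ []))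

  walk-parity : ∀ {σ} → (∀ u v → σ u v ≡ σ v u) →
                walkParity σ (r , c) walk ≡ walkParity σ (r , c) (replicate (suc p + suc (suc q)) right) xor rectangleParity σ (r , a) d
  walk-parity {σ} σ-sym = begin
    walkParity σ (r , c) walk
      ≡⟨ walkParity-++ σ (replicate (suc p) right) _ (endpoint-rights (suc p) r c) ⟩
    A xor walkParity σ (r , a) (replicate d down ++ right ∷ replicate d up ++ replicate (suc q) right)
      ≡⟨ cong (A xor_) (walkParity-++ σ (replicate d down) _ (endpoint-downs d r a)) ⟩
    A xor (B xor (G xor walkParity σ (r + d , suc a) (replicate d up ++ replicate (suc q) right)))
      ≡⟨ cong (λ z → A xor (B xor (G xor z))) (walkParity-++ σ (replicate d up) _ (endpoint-ups d r (suc a))) ⟩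
    A xor (B xor (G xor (walkParity σ (r + d , suc a) (replicate d up) xor E)))
      ≡⟨ cong (λ z → A xor (B xor (G xor (z xor E)))) (walkParity-ups σ-sym d r (suc a)) ⟩
    A xor (B xor (G xor (B' xor E)))
      ≡⟨ regroup A B G B' E T ⟩
    (A xor (T xor E)) xor rectangleParity σ (r , a) d
      ≡⟨ cong (_xor rectangleParity σ (r , a) d) straight ⟨
    walkParity σ (r , c) (replicate (suc p + suc (suc q)) right) xor rectangleParity σ (r , a) d ∎
    where
    open ≡-Reasoning
    A B B' G T E : Bool
    A  = walkParity σ (r , c) (replicate (suc p) right)
    B  = walkParity σ (r , a) (replicate d down)
    B' = walkParity σ (r , suc a) (replicate d down)
    G  = σ (r + d , a) (r + d , suc a)
    T  = σ (r , a) (r , suc a)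
    E  = walkParity σ (r , suc a) (replicate (suc q) right)
    regroup : ∀ A B G B' E T → A xor (B xor (G xor (B' xor E))) ≡ (A xor (T xor E)) xor (B xor (G xor (B' xor T)))
    regroup = solve-∀ ℤ₂
    straight : walkParity σ (r , c) (replicate (suc p + suc (suc q)) right) ≡ A xor (T xor E)
    straight = trans (cong (walkParity σ (r , c)) (replicate-+ (suc p) (suc (suc q)) right))
                     (walkParity-++ σ (replicate (suc p) right) _ (endpoint-rights (suc p) r c))

block-< : ∀ {a b i s} → i < a → s < b → i * b + s < a * b
block-< {a} {b} {i} {s} i<a s<b = begin-strict
  i * b + s  <⟨ +-monoʳ-< (i * b) s<b ⟩
  i * b + b  ≡⟨ +-comm (i * b) b ⟩
  suc i * b  ≤⟨ *-monoˡ-≤ b i<a ⟩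
  a * b      ∎
  where open ≤-Reasoning

block-divMod : ∀ {n} .{{_ : NonZero n}} i {s} → s < n → (i * n + s) / n ≡ i × (i * n + s) % n ≡ s
block-divMod {n} i {s} s<n = quotient , remainder
  where
  remainder : (i * n + s) % n ≡ s
  remainder = trans (cong (_% n) (+-comm (i * n) s)) (trans ([m+kn]%n≡m%n s i n) (m<n⇒m%n≡m s<n))
  quotient : (i * n + s) / n ≡ i
  quotient = begin
    (i * n + s) / n      ≡⟨ +-distrib-/ (i * n) s (subst₂ (λ u v → u + v < n) (sym (m*n%n≡0 i n)) (sym (m<n⇒m%n≡m s<n)) s<n) ⟩
    i * n / n + s / n    ≡⟨ cong₂ _+_ (m*n/n≡m i n) (m<n⇒m/n≡0 s<n) ⟩
    i + 0                ≡⟨ +-identityʳ i ⟩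
    i                    ∎
    where open ≡-Reasoning

within-block : ∀ {n} .{{_ : NonZero n}} i {x} → i * n ≤ x → x < i * n + n → x / n ≡ i × x % n ≡ x ∸ i * n
within-block {n} i {x} lo hi =
  subst (λ y → y / n ≡ i × y % n ≡ x ∸ i * n) (m+[n∸m]≡n lo) (block-divMod i (m<n+o⇒m∸n<o x (i * n) hi))

m*[2+m]<[1+m]*[1+m] : ∀ m → m * suc (suc m) < suc m * suc m
m*[2+m]<[1+m]*[1+m] m = ≤-reflexive (square m)
  where
  square : ∀ m → suc (m * suc (suc m)) ≡ suc m * suc m
  square = ℕ-Solver.solve-∀

module _ {a b c d : ℕ} (f : ℕ → ℕ → ℕ → ℕ → Bool) where

  private
    somewhere? : ∀ (i : Fin a) (j : Fin b) → Dec (∃₂ λ (p : Fin c) (e : Fin d) → f (toℕ i) (toℕ j) (toℕ p) (toℕ e) ≡ true)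
    somewhere? i j = Fin.any? λ p → Fin.any? λ e → f (toℕ i) (toℕ j) (toℕ p) (toℕ e) Bool.≟ true

  bounded-dichotomy :
    (∀ i j → i < a → j < b → ∃₂ λ p e → p < c × e < d × f i j p e ≡ true) ⊎
    (∃₂ λ i j → i < a × j < b × ∀ p e → p < c → e < d → f i j p e ≡ false)
  bounded-dichotomy with Fin.all? (λ i → Fin.all? (somewhere? i))
  ... | yes everywhere = inj₁ λ i j i<a j<b →
    let p , e , fpe = everywhere (fromℕ< i<a) (fromℕ< j<b)
    in toℕ p , toℕ e , Fin.toℕ<n p , Fin.toℕ<n e ,
       subst₂ (λ i j → f i j (toℕ p) (toℕ e) ≡ true) (Fin.toℕ-fromℕ< i<a) (Fin.toℕ-fromℕ< j<b) fpe
  ... | no ¬everywhere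
    with i , ¬everywhere-i ← Fin.¬∀⟶∃¬ a _ (λ i → Fin.all? (somewhere? i)) ¬everywhere
    with j , nowhere ← Fin.¬∀⟶∃¬ b _ (somewhere? i) ¬everywhere-i
    = inj₂ (toℕ i , toℕ j , Fin.toℕ<n i , Fin.toℕ<n j , λ p e p<c e<d → ¬-not λ fpe →
        nowhere (fromℕ< p<c , fromℕ< e<d ,
                 subst₂ (λ p e → f (toℕ i) (toℕ j) p e ≡ true) (sym (Fin.toℕ-fromℕ< p<c)) (sym (Fin.toℕ-fromℕ< e<d)) fpe))

-- Embedding lattice walks into the N × N grid

module Embedding (N : ℕ) .{{_ : NonZero N}} where

  -- mod only makes toV total: every point that occurs below is in range.
  toV : Point → Vtx N
  toV (r , c) = r mod N , c mod N

  toPoint : Vtx N → Point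
  toPoint (x , y) = toℕ x , toℕ y

  InRange : Point → Set
  InRange (r , c) = r < N × c < N

  toPoint-toV : ∀ {p} → InRange p → toPoint (toV p) ≡ p
  toPoint-toV (r<N , c<N) = cong₂ _,_ (toℕ-mod r<N) (toℕ-mod c<N)
    where
    toℕ-mod : ∀ {a} → a < N → toℕ (a mod N) ≡ a
    toℕ-mod a<N = trans (Fin.toℕ-fromℕ< _) (m<n⇒m%n≡m a<N)

  toV-injective : ∀ {p q} → InRange p → InRange q → toV p ≡ toV q → p ≡ q
  toV-injective ip iq eq = trans (sym (toPoint-toV ip)) (trans (cong toPoint eq) (toPoint-toV iq))

  toV-adjacent : ∀ {p q} → InRange p → InRange q → Adjacent p q → Adj (toV p) (toV q)
  toV-adjacent ip iq = subst₂ Adjacent (sym (toPoint-toV ip)) (sym (toPoint-toV iq))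

  toPoint-∈-map : ∀ {x L} → All InRange L → x ∈ map toV L → toPoint x ∈ L
  toPoint-∈-map inRange x∈ with p , p∈L , refl ← ∈-map⁻ toV x∈ =
    subst (_∈ _) (sym (toPoint-toV (All.lookup inRange p∈L))) p∈L

  toV-isWalk : ∀ {s ms} → IsLatticeWalk s ms → All InRange (s ∷ trace s ms) → IsWalk (map toV (s ∷ trace s ms))
  toV-isWalk {ms = []}     _          _                       = single
  toV-isWalk {ms = x ∷ ms} (adj , w) (is ∷ inRange@(im ∷ _)) = step (toV-adjacent is im adj) (toV-isWalk w inRange)

  toV-unique : ∀ {L} → All InRange L → Unique L → Unique (map toV L)
  toV-unique []             []          = []
  toV-unique (ip ∷ inRange) (p∉ ∷ uL) =
    All-map⁺ (All.tabulate λ q∈L eq → All.lookup p∉ q∈L (toV-injective ip (All.lookup inRange q∈L) eq)) ∷ toV-unique inRange uL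

  toV-parityL : ∀ γ s ms → parityL γ (map toV (s ∷ trace s ms)) ≡ walkParity (λ u v → γ (toV u) (toV v)) s ms
  toV-parityL γ s []       = refl
  toV-parityL γ s (x ∷ ms) = cong (γ (toV s) (toV (move s x)) xor_) (toV-parityL γ (move s x) ms)

  module _ {s ms mid e} (trace≡ : trace s ms ≡ mid ∷ʳ e) where

    toV-pathVerts : map toV (s ∷ trace s ms) ≡ pathVerts (toV s) (map toV mid) (toV e)
    toV-pathVerts = cong (toV s ∷_) (trans (cong (map toV) trace≡) (map-++ toV mid (e ∷ [])))

    toV-isPath : IsLatticeWalk s ms → Unique (s ∷ trace s ms) → InRange s → All InRange mid → InRange e →
                 IsPath (toV s) (map toV mid) (toV e)
    toV-isPath w u is im ie =
      subst IsWalk toV-pathVerts (toV-isWalk w inRange) , subst Unique toV-pathVerts (toV-unique inRange u)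
      where
      inRange : All InRange (s ∷ trace s ms)
      inRange = is ∷ subst (All InRange) (sym trace≡) (All-++⁺ im (ie ∷ []))

    toV-parity : ∀ γ → parity γ (toV s) (map toV mid) (toV e) ≡ walkParity (λ u v → γ (toV u) (toV v)) s ms
    toV-parity γ = trans (cong (parityL γ) (sym toV-pathVerts)) (toV-parityL γ s ms)

-- The block decomposition of the k² × k² grid

module BlockDecomposition (m : ℕ) (γ : Signing (suc m * suc m)) (γ-sym : Symmetric γ) where

  k N : ℕ
  k = suc m
  N = k * k

  open Embedding N

  σ : LatticeSigning
  σ u v = γ (toV u) (toV v)

  σ-sym : ∀ u v → σ u v ≡ σ v u
  σ-sym u v = γ-sym (toV u) (toV v)

  corner : ℕ → ℕ → Point
  corner i j = i * k , j * suc k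

  rectangleAt : ℕ → ℕ → ℕ → ℕ → Bool
  rectangleAt i j p d = rectangleParity σ (i * k , j * suc k + suc p) d

  column<N : ∀ {y} → y ≤ m * suc k → y < N
  column<N y≤ = ≤-<-trans y≤ (m*[2+m]<[1+m]*[1+m] m)

  column<m : ∀ {j j' : Fin k} → toℕ j' ≡ suc (toℕ j) → toℕ j < m
  column<m h = s≤s⁻¹ (suc-toℕ<n h)

  corner-inRange : ∀ {i j} → i < k → j ≤ m → InRange (corner i j)
  corner-inRange {i} i<k j≤m =
    subst (_< N) (+-identityʳ (i * k)) (block-< i<k (s≤s z≤n)) , column<N (*-monoˡ-≤ (suc k) j≤m)

  block offset : Point → ℕ × ℕ
  block  (x , y) = x / k , y / suc k
  offset (x , y) = x % k , y % suc k

  corner-offset : ∀ i j → offset (corner i j) ≡ (0 , 0)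
  corner-offset i j = cong₂ _,_ (m*n%n≡0 i k) (m*n%n≡0 j (suc k))

  Corridor : ∀ {uv : Vtx k × Vtx k} → EdgeView uv → Point → Set
  Corridor (horizontal i {j} _) p = block p ≡ (toℕ i , toℕ j) × proj₂ (offset p) ≢ 0
  Corridor (vertical {i} j _)   p = block p ≡ (toℕ i , toℕ j) × proj₂ (offset p) ≡ 0 × proj₁ (offset p) ≢ 0

  corridors-disjoint : ∀ {uv uv' p} (v : EdgeView uv) (v' : EdgeView uv') → Corridor v p → Corridor v' p → uv ≡ uv'
  corridors-disjoint (horizontal i h) (horizontal i' h') (b , _) (b' , _)
    with refl ← Fin.toℕ-injective (cong proj₁ (trans (sym b) b'))
       | refl ← Fin.toℕ-injective (cong proj₂ (trans (sym b) b'))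
    with refl ← Fin.toℕ-injective (trans h (sym h')) = refl
  corridors-disjoint (vertical j h) (vertical j' h') (b , _) (b' , _)
    with refl ← Fin.toℕ-injective (cong proj₁ (trans (sym b) b'))
       | refl ← Fin.toℕ-injective (cong proj₂ (trans (sym b) b'))
    with refl ← Fin.toℕ-injective (trans h (sym h')) = refl
  corridors-disjoint (horizontal _ _) (vertical _ _) (_ , nonzero) (_ , isZero , _) = ⊥-elim (nonzero isZero)
  corridors-disjoint (vertical _ _) (horizontal _ _) (_ , isZero , _) (_ , nonzero) = ⊥-elim (nonzero isZero)

  corridor-avoids-corners : ∀ {uv p} (v : EdgeView uv) → Corridor v p → ∀ i j → p ≢ corner i j
  corridor-avoids-corners (horizontal _ _) (_ , nonzero)     i j refl = nonzero (cong proj₂ (corner-offset i j))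
  corridor-avoids-corners (vertical _ _)   (_ , _ , nonzero) i j refl = nonzero (cong proj₁ (corner-offset i j))

  record Shape : Set where
    constructor shape
    field
      p d q   : ℕ
      fits    : suc p + suc q ≡ k
      shallow : d < k

  module HorizontalRoute (i j : ℕ) (i<k : i < k) (j<m : j < m) (S : Shape) where
    open Shape S
    open Detour (i * k) (j * suc k) p d q public

    exit≡corner : exit ≡ corner i (suc j)
    exit≡corner = cong (i * k ,_) (begin
      suc (j * suc k + suc p) + suc q  ≡⟨ regroup (j * suc k) p q ⟩
      j * suc k + suc (suc p + suc q)  ≡⟨ cong (λ w → j * suc k + suc w) fits ⟩
      j * suc k + suc k                ≡⟨ +-comm (j * suc k) (suc k) ⟩
      suc j * suc k                    ∎)
      where
      open ≡-Reasoning
      regroup : ∀ c p q → suc (c + suc p) + suc q ≡ c + suc (suc p + suc q)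
      regroup = ℕ-Solver.solve-∀

    column<exit : ∀ {y} → y ≤ suc a + q → y < suc j * suc k
    column<exit y≤ =
      ≤-<-trans y≤ (subst (suc a + q <_) (cong proj₂ exit≡corner) (+-monoʳ-< (suc a) (n<1+n q)))

    interior-inRange : All InRange interior
    interior-inRange = All.map inRange interior-inBox
      where
      inRange : ∀ {x} → InBox (i * k , suc (j * suc k)) (i * k + d , suc a + q) x → InRange x
      inRange (box _ hr _ hc) =
        ≤-<-trans hr (block-< i<k shallow) , column<N (<⇒≤ (<-≤-trans (column<exit hc) (*-monoˡ-≤ (suc k) j<m)))

    interior-corridor : All (λ x → block x ≡ (i , j) × proj₂ (offset x) ≢ 0) interior
    interior-corridor = All.map corridor interior-inBox
      where
      corridor : ∀ {x} → InBox (i * k , suc (j * suc k)) (i * k + d , suc a + q) x →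
                 block x ≡ (i , j) × proj₂ (offset x) ≢ 0
      corridor {x , y} (box lr hr lc hc)
        with row/ , _ ← within-block i lr (≤-<-trans hr (+-monoʳ-< (i * k) shallow))
           | col/ , col% ← within-block j (<⇒≤ lc) (subst (y <_) (+-comm (suc k) (j * suc k)) (column<exit hc))
        = cong₂ _,_ row/ col/ , λ col%≡0 → <⇒≢ (m<n⇒0<n∸m lc) (sym (trans (sym col%) col%≡0))

    interior-isPath : IsPath (toV (corner i j)) (map toV interior) (toV (corner i (suc j)))
    interior-isPath = subst (λ e → IsPath (toV (corner i j)) (map toV interior) (toV e)) exit≡corner
      (toV-isPath {s = corner i j} {ms = walk} trace-walk walk-isLatticeWalk walk-unique
                  (corner-inRange i<k (<⇒≤ j<m)) interior-inRange (subst InRange (sym exit≡corner) (corner-inRange i<k j<m)))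

    interior-parity : parity γ (toV (corner i j)) (map toV interior) (toV (corner i (suc j)))
                      ≡ walkParity σ (corner i j) walk
    interior-parity =
      subst (λ e → parity γ (toV (corner i j)) (map toV interior) (toV e) ≡ walkParity σ (corner i j) walk) exit≡corner
            (toV-parity {s = corner i j} {ms = walk} {interior} {exit} trace-walk γ)

    walk-parity-in-block : walkParity σ (corner i j) walk
                           ≡ walkParity σ (corner i j) (replicate (suc k) right) xor rectangleAt i j p d
    walk-parity-in-block =
      trans (walk-parity σ-sym) (cong (λ n → walkParity σ (corner i j) (replicate n right) xor rectangleAt i j p d)
                                      (trans (+-suc (suc p) (suc q)) (cong suc fits)))

  shapeAt : ∀ {p} → p < m → ∀ {d} → d < k → Shape
  shapeAt {p} p<m {d} d<k = shape p d (m ∸ suc p) (trans (+-suc (suc p) (m ∸ suc p)) (cong suc (m+[n∸m]≡n p<m))) d<k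

  OddBlock : ℕ → ℕ → Set
  OddBlock i j = ∃₂ λ p d → p < m × d < k × rectangleAt i j p d ≡ true

  -- Depth 0 gives the straight route; descending around the odd rectangle flips its parity.
  shape-with-parity : ∀ {i j} (i<k : i < k) (j<m : j < m) → OddBlock i j →
                      ∀ b → Σ Shape λ S → walkParity σ (corner i j) (HorizontalRoute.walk i j i<k j<m S) ≡ b
  shape-with-parity {i} {j} i<k j<m (p , d , p<m , d<k , odd) b
    with walkParity σ (corner i j) (replicate (suc k) right) Bool.≟ b
  ... | yes straight≡b = shapeAt p<m (s≤s z≤n) ,
    trans (HorizontalRoute.walk-parity-in-block i j i<k j<m (shapeAt p<m (s≤s z≤n)))
          (trans (cong₂ _xor_ straight≡b (rectangleParity-0 σ (i * k) _)) (xor-identityʳ b))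
  ... | no straight≢b = shapeAt p<m d<k ,
    trans (HorizontalRoute.walk-parity-in-block i j i<k j<m (shapeAt p<m d<k))
          (trans (cong₂ _xor_ (¬-not straight≢b) odd) (trans (xor-comm (not b) true) (not-involutive b)))

  module VerticalRoute (i j : ℕ) (1+i<k : suc i < k) (j<k : j < k) where

    interior : List Point
    interior = applyUpTo (λ t → i * k + suc t , j * suc k) m

    exit≡corner : (i * k + k , j * suc k) ≡ corner (suc i) j
    exit≡corner = cong (_, j * suc k) (+-comm (i * k) k)

    trace-walk : trace (corner i j) (replicate k down) ≡ interior ∷ʳ corner (suc i) j
    trace-walk =
      trans (trace-downs k (i * k) (j * suc k)) (trans (sym (applyUpTo-∷ʳ _ m)) (cong (interior ∷ʳ_) exit≡corner))

    interior-inRange : All InRange interior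
    interior-inRange = applyUpTo⁺₁ _ m λ t<m →
      block-< (<-trans (n<1+n i) 1+i<k) (s≤s t<m) , column<N (*-monoˡ-≤ (suc k) (s≤s⁻¹ j<k))

    interior-corridor : All (λ x → block x ≡ (i , j) × proj₂ (offset x) ≡ 0 × proj₁ (offset x) ≢ 0) interior
    interior-corridor = applyUpTo⁺₁ _ m λ {t} t<m →
      let row/ , row% = block-divMod i (s≤s t<m)
      in cong₂ _,_ row/ (m*n/n≡m j (suc k)) , m*n%n≡0 j (suc k) , λ row%≡0 → 0≢1+n (trans (sym row%≡0) row%)

    interior-isPath : IsPath (toV (corner i j)) (map toV interior) (toV (corner (suc i) j))
    interior-isPath =
      toV-isPath {s = corner i j} {ms = replicate k down} trace-walk (downs-isLatticeWalk k _ _) (downs-unique k _ _)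
                 (corner-inRange (<-trans (n<1+n i) 1+i<k) (s≤s⁻¹ j<k)) interior-inRange (corner-inRange 1+i<k (s≤s⁻¹ j<k))

    interior-parity : parity γ (toV (corner i j)) (map toV interior) (toV (corner (suc i) j))
                      ≡ walkParity σ (corner i j) (replicate k down)
    interior-parity = toV-parity {s = corner i j} {ms = replicate k down} {interior} {corner (suc i) j} trace-walk γ

  module OddEverywhere (odd : ∀ i j → i < k → j < m → OddBlock i j) where

    branch : Vtx k → Vtx N
    branch (i , j) = toV (corner (toℕ i) (toℕ j))

    potential : Vtx k → Bool
    potential (i , j) = walkParity σ (0 , toℕ j * suc k) (replicate (toℕ i * k) down)

    chosenShape : ∀ i {j j'} (h : toℕ j' ≡ suc (toℕ j)) →
                  Σ Shape λ S → walkParity σ (corner (toℕ i) (toℕ j)) (HorizontalRoute.walk _ _ (Fin.toℕ<n i) (column<m h) S)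
                                ≡ potential (i , j) xor potential (i , j')
    chosenShape i {j} {j'} h = shape-with-parity (Fin.toℕ<n i) (column<m h) (odd _ _ (Fin.toℕ<n i) (column<m h)) _

    module H (i : Fin k) {j j' : Fin k} (h : toℕ j' ≡ suc (toℕ j)) =
      HorizontalRoute (toℕ i) (toℕ j) (Fin.toℕ<n i) (column<m h) (proj₁ (chosenShape i h))
    module V {i i' : Fin k} (j : Fin k) (h : toℕ i' ≡ suc (toℕ i)) =
      VerticalRoute (toℕ i) (toℕ j) (suc-toℕ<n h) (Fin.toℕ<n j)

    routeOf : ∀ {uv} → EdgeView uv → List (Vtx N)
    routeOf (horizontal i h) = map toV (H.interior i h)
    routeOf (vertical j h)   = map toV (V.interior j h)

    routeOf-isPath : ∀ {uv} (v : EdgeView uv) → IsPath (branch (proj₁ uv)) (routeOf v) (branch (proj₂ uv))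
    routeOf-isPath (horizontal i {j} h) =
      subst (λ n → IsPath (branch (i , j)) (routeOf (horizontal i h)) (toV (corner (toℕ i) n))) (sym h) (H.interior-isPath i h)
    routeOf-isPath (vertical {i} j h) =
      subst (λ n → IsPath (branch (i , j)) (routeOf (vertical j h)) (toV (corner n (toℕ j)))) (sym h) (V.interior-isPath j h)

    downs-parity-split : ∀ i c → walkParity σ (0 , c) (replicate (suc i * k) down)
                             ≡ walkParity σ (0 , c) (replicate (i * k) down) xor walkParity σ (i * k , c) (replicate k down)
    downs-parity-split i c =
      trans (cong (λ n → walkParity σ (0 , c) (replicate n down)) (+-comm k (i * k)))
     (trans (cong (walkParity σ (0 , c)) (replicate-+ (i * k) k down))
            (walkParity-++ σ (replicate (i * k) down) _ (endpoint-downs (i * k) 0 c)))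

    routeOf-parity : ∀ {uv} (v : EdgeView uv) →
                     parity γ (branch (proj₁ uv)) (routeOf v) (branch (proj₂ uv)) ≡ potential (proj₁ uv) xor potential (proj₂ uv)
    routeOf-parity (horizontal i {j} h) =
      trans (subst (λ n → parity γ (branch (i , j)) (routeOf (horizontal i h)) (toV (corner (toℕ i) n)) ≡ walkParity σ _ (H.walk i h))
                   (sym h) (H.interior-parity i h))
            (proj₂ (chosenShape i h))
    routeOf-parity (vertical {i} {i'} j h) = begin
      parity γ (branch (i , j)) (routeOf (vertical j h)) (branch (i' , j))
        ≡⟨ subst (λ n → parity γ (branch (i , j)) (routeOf (vertical j h)) (toV (corner n (toℕ j))) ≡ R) (sym h) (V.interior-parity j h) ⟩
      R
        ≡⟨ cong (_xor R) (xor-same P) ⟨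
      (P xor P) xor R
        ≡⟨ xor-assoc P P R ⟩
      P xor (P xor R)
        ≡⟨ cong (P xor_) (trans (sym (downs-parity-split (toℕ i) (toℕ j * suc k)))
                                (cong (λ n → walkParity σ (0 , toℕ j * suc k) (replicate (n * k) down)) (sym h))) ⟩
      P xor potential (i' , j) ∎
      where
      open ≡-Reasoning
      P R : Bool
      P = potential (i , j)
      R = walkParity σ (corner (toℕ i) (toℕ j)) (replicate k down)

    routeOf-corridor : ∀ {uv x} (v : EdgeView uv) → x ∈ routeOf v → Corridor v (toPoint x)
    routeOf-corridor (horizontal i h) x∈ = All.lookup (H.interior-corridor i h) (toPoint-∈-map (H.interior-inRange i h) x∈)
    routeOf-corridor (vertical j h)   x∈ = All.lookup (V.interior-corridor j h) (toPoint-∈-map (V.interior-inRange j h) x∈)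

    toPoint-branch : ∀ w → toPoint (branch w) ≡ corner (toℕ (proj₁ w)) (toℕ (proj₂ w))
    toPoint-branch (i , j) = toPoint-toV (corner-inRange (Fin.toℕ<n i) (s≤s⁻¹ (Fin.toℕ<n j)))

    branch-injective : Injective _≡_ _≡_ branch
    branch-injective {i , j} {i' , j'} eq =
      cong₂ _,_ (Fin.toℕ-injective (*-cancelʳ-≡ _ _ k (cong proj₁ corners≡)))
                (Fin.toℕ-injective (*-cancelʳ-≡ _ _ (suc k) (cong proj₂ corners≡)))
      where
      corners≡ : corner (toℕ i) (toℕ j) ≡ corner (toℕ i') (toℕ j')
      corners≡ = trans (sym (toPoint-branch (i , j))) (trans (cong toPoint eq) (toPoint-branch (i' , j')))

    model : ShiftedSubdivision N γ k
    model = record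
      { branch           = branch
      ; route            = λ e → routeOf (edgeView e)
      ; potential        = potential
      ; branch-injective = branch-injective
      ; route-isPath     = λ e → routeOf-isPath (edgeView e)
      ; route-parity     = λ e → routeOf-parity (edgeView e)
      ; routes-disjoint  = λ e e' x x∈e x∈e' →
          corridors-disjoint (edgeView e) (edgeView e') (routeOf-corridor (edgeView e) x∈e) (routeOf-corridor (edgeView e') x∈e')
      ; routes-avoid-branches = λ e x w x∈e x≡w →
          corridor-avoids-corners (edgeView e) (routeOf-corridor (edgeView e) x∈e) (toℕ (proj₁ w)) (toℕ (proj₂ w))
            (trans (cong toPoint x≡w) (toPoint-branch w))
      }

  module BalancedBlock (i₀ j₀ : ℕ) (i₀<k : i₀ < k) (j₀<m : j₀ < m)
                       (balanced : ∀ p d → p < m → d < k → rectangleAt i₀ j₀ p d ≡ false) where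

    r c : ℕ
    r = i₀ * k
    c = j₀ * suc k

    point : ℕ → ℕ → Point
    point s t = r + s , c + suc t

    pointOf : Vtx k → Point
    pointOf (s , t) = point (toℕ s) (toℕ t)

    pointOf-inRange : ∀ w → InRange (pointOf w)
    pointOf-inRange (s , t) = block-< i₀<k (Fin.toℕ<n s) , column<N (<⇒≤ (block-< j₀<m (s≤s (Fin.toℕ<n t))))

    branch : Vtx k → Vtx N
    branch w = toV (pointOf w)

    branch-injective : Injective _≡_ _≡_ branch
    branch-injective {s , t} {s' , t'} eq =
      cong₂ _,_ (Fin.toℕ-injective (+-cancelˡ-≡ r _ _ (cong proj₁ points≡)))
                (Fin.toℕ-injective (suc-injective (+-cancelˡ-≡ c _ _ (cong proj₂ points≡))))
      where
      points≡ : pointOf (s , t) ≡ pointOf (s' , t')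
      points≡ = toV-injective (pointOf-inRange _) (pointOf-inRange _) eq

    potentialℕ : ℕ → ℕ → Bool
    potentialℕ s t = walkParity σ (r , c) (replicate (suc t) right) xor walkParity σ (r , c + suc t) (replicate s down)

    potential : Vtx k → Bool
    potential (s , t) = potentialℕ (toℕ s) (toℕ t)

    right-edge-parity : ∀ s t → s < k → t < m → σ (point s t) (move (point s t) right) ≡ potentialℕ s t xor potentialℕ s (suc t)
    right-edge-parity s t s<k t<m = begin
      G                                  ≡⟨ xor-identityʳ G ⟨
      G xor false                        ≡⟨ cong (G xor_) (balanced t s t<m s<k) ⟨
      G xor (D xor (G xor (D' xor T)))   ≡⟨ regroup R D G D' T ⟩
      (R xor D) xor ((R xor T) xor D')   ≡⟨ cong₂ (λ u v → (R xor D) xor (u xor v)) right-step down-step ⟨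
      potentialℕ s t xor potentialℕ s (suc t) ∎
      where
      open ≡-Reasoning
      a = c + suc t
      R D D' G T : Bool
      R  = walkParity σ (r , c) (replicate (suc t) right)
      D  = walkParity σ (r , a) (replicate s down)
      D' = walkParity σ (r , suc a) (replicate s down)
      G  = σ (r + s , a) (r + s , suc a)
      T  = σ (r , a) (r , suc a)
      regroup : ∀ R D G D' T → G xor (D xor (G xor (D' xor T))) ≡ (R xor D) xor ((R xor T) xor D')
      regroup = solve-∀ ℤ₂
      right-step : walkParity σ (r , c) (replicate (suc (suc t)) right) ≡ R xor T
      right-step = trans (cong (walkParity σ (r , c)) (sym (replicate-∷ʳ (suc t) right)))
                         (walkParity-∷ʳ σ (replicate (suc t) right) right (endpoint-rights (suc t) r c))
      down-step : walkParity σ (r , c + suc (suc t)) (replicate s down) ≡ D'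
      down-step = cong (λ y → walkParity σ (r , y) (replicate s down)) (+-suc c (suc t))

    down-edge-parity : ∀ s t → σ (point s t) (move (point s t) down) ≡ potentialℕ s t xor potentialℕ (suc s) t
    down-edge-parity s t = begin
      G                                   ≡⟨ regroup R D G ⟩
      (R xor D) xor (R xor (D xor G))     ≡⟨ cong (λ u → (R xor D) xor (R xor u)) down-step ⟨
      potentialℕ s t xor potentialℕ (suc s) t ∎
      where
      open ≡-Reasoning
      a = c + suc t
      R D G : Bool
      R = walkParity σ (r , c) (replicate (suc t) right)
      D = walkParity σ (r , a) (replicate s down)
      G = σ (r + s , a) (suc (r + s) , a)
      regroup : ∀ R D G → G ≡ (R xor D) xor (R xor (D xor G))
      regroup = solve-∀ ℤ₂
      down-step : walkParity σ (r , a) (replicate (suc s) down) ≡ D xor G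
      down-step = trans (cong (walkParity σ (r , a)) (sym (replicate-∷ʳ s down)))
                        (walkParity-∷ʳ σ (replicate s down) down (endpoint-downs s r a))

    right-of : ∀ {i j j' : Fin k} → toℕ j' ≡ suc (toℕ j) → pointOf (i , j') ≡ move (pointOf (i , j)) right
    right-of {i} {j} h = cong (r + toℕ i ,_) (trans (cong (λ n → c + suc n) h) (+-suc c (suc (toℕ j))))

    below : ∀ {i i' j : Fin k} → toℕ i' ≡ suc (toℕ i) → pointOf (i' , j) ≡ move (pointOf (i , j)) down
    below {i} {j = j} h = cong (_, c + suc (toℕ j)) (trans (cong (r +_) h) (+-suc r (toℕ i)))

    edge-isPath : ∀ {uv} → EdgeView uv → IsPath (branch (proj₁ uv)) [] (branch (proj₂ uv))
    edge-isPath (horizontal i {j} {j'} h) =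
      adjacent⇒isPath (toV-adjacent (pointOf-inRange (i , j)) (pointOf-inRange (i , j'))
                                    (subst (Adjacent (pointOf (i , j))) (sym (right-of h)) (right-adjacent (r + toℕ i) (c + suc (toℕ j)))))
    edge-isPath (vertical {i} {i'} j h) =
      adjacent⇒isPath (toV-adjacent (pointOf-inRange (i , j)) (pointOf-inRange (i' , j))
                                    (subst (Adjacent (pointOf (i , j))) (sym (below h)) (down-adjacent (r + toℕ i) (c + suc (toℕ j)))))

    edge-parity : ∀ {uv} → EdgeView uv → parity γ (branch (proj₁ uv)) [] (branch (proj₂ uv)) ≡ potential (proj₁ uv) xor potential (proj₂ uv)
    edge-parity (horizontal i {j} {j'} h) =
      trans (xor-identityʳ _)
     (trans (cong (σ (pointOf (i , j))) (right-of h))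
     (trans (right-edge-parity (toℕ i) (toℕ j) (Fin.toℕ<n i) (column<m h))
            (cong (λ n → potential (i , j) xor potentialℕ (toℕ i) n) (sym h))))
    edge-parity (vertical {i} {i'} j h) =
      trans (xor-identityʳ _)
     (trans (cong (σ (pointOf (i , j))) (below h))
     (trans (down-edge-parity (toℕ i) (toℕ j))
            (cong (λ n → potential (i , j) xor potentialℕ n (toℕ j)) (sym h))))

    model : ShiftedSubdivision N γ k
    model = record
      { branch           = branch
      ; route            = λ _ → []
      ; potential        = potential
      ; branch-injective = branch-injective
      ; route-isPath     = λ e → edge-isPath (edgeView e)
      ; route-parity     = λ e → edge-parity (edgeView e)
      ; routes-disjoint  = λ _ _ _ ()
      ; routes-avoid-branches = λ _ _ _ ()
      }

mainTheorem5 : (k : ℕ) (γ : Signing (k * k)) → Symmetric γ →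
               ContainsSubdivision (k * k) γ k γ₀
mainTheorem5 zero    γ _     = toContainsSubdivision (emptyGrid-subdivision γ)
mainTheorem5 (suc m) γ γ-sym = toContainsSubdivision (case bounded-dichotomy rectangleAt of λ where
    (inj₁ odd-everywhere)                      → OddEverywhere.model odd-everywhere
    (inj₂ (i , j , i<k , j<m , balanced-block)) → BalancedBlock.model i j i<k j<m balanced-block)
  where open BlockDecomposition m γ γ-sym
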